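{- Let $\mathcal{Z}$ be an expansion of $(\mathbb{Z},+,0,1)$, and suppose that $A\subseteq\mathbb{N}$ is definable in $\mathcal{Z}$ and is syndetic. Then $\mathcal{Z}$ defines $\mathbb{N}$, and hence defines the order $<$.
   Context: Here $\mathbb{N}=\{0,1,2,\dots\}$. An expansion of $(\mathbb{Z},+,0,1)$ is a structure with universe $\mathbb{Z}$ in a language containing $+,0,1$ with their usual interpretation; "definable" means definable with parameters. A set $A\subseteq\mathbb{N}$ is syndetic if there is a finite set $F\subseteq\mathbb{N}$ such that $\mathbb{N}\subseteq\bigcup_{n\in F}(A-n)$. -}

module Defs where

open import Data.Nat using (ℕ; suc; _+_)
open import Data.Integer as ℤ using (ℤ; +_)
open import Data.Fin using (Fin)
open import Data.Vec using (Vec; []; _∷_; lookup; _++_)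
open import Data.List using (List)
open import Data.List.Membership.Propositional using (_∈_)
open import Data.Product using (Σ; _×_)
open import Data.Sum using (_⊎_)
open import Data.Empty using (⊥)
open import Data.Unit using (⊤)
open import Relation.Binary.PropositionalEquality using (_≡_)
open import Function.Bundles using (_⇔_)

record ZExpansion : Set₁ where
  field
    Func : ℕ → Set
    Rel  : ℕ → Set
    funI : ∀ {k} → Func k → Vec ℤ k → ℤ
    relI : ∀ {k} → Rel k → Vec ℤ k → Set
    plus : Func 2
    zer  : Func 0
    one  : Func 0
    plus-ok : ∀ a b → funI plus (a ∷ b ∷ []) ≡ a ℤ.+ b
    zer-ok  : funI zer [] ≡ + 0
    one-ok  : funI one [] ≡ + 1

module _ (Z : ZExpansion) where
  open ZExpansion Z

  -- terms and formulas with n free variables (de Bruijn, Fin n)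
  data Term (n : ℕ) : Set where
    var : Fin n → Term n
    app : ∀ {k} → Func k → Vec (Term n) k → Term n

  data Formula (n : ℕ) : Set where
    tt ff : Formula n
    _≐_   : Term n → Term n → Formula n
    rel   : ∀ {k} → Rel k → Vec (Term n) k → Formula n
    ¬f_   : Formula n → Formula n
    _∧f_ _∨f_ _⇒f_ : Formula n → Formula n → Formula n
    ∀f ∃f : Formula (suc n) → Formula n

  mutual
    evalT : ∀ {n} → Vec ℤ n → Term n → ℤ
    evalT ρ (var i)    = lookup ρ i
    evalT ρ (app f ts) = funI f (evalTs ρ ts)

    evalTs : ∀ {n k} → Vec ℤ n → Vec (Term n) k → Vec ℤ k
    evalTs ρ []       = []
    evalTs ρ (t ∷ ts) = evalT ρ t ∷ evalTs ρ ts

  Sat : ∀ {n} → Vec ℤ n → Formula n → Set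
  Sat ρ tt        = ⊤
  Sat ρ ff        = ⊥
  Sat ρ (s ≐ t)   = evalT ρ s ≡ evalT ρ t
  Sat ρ (rel r ts) = relI r (evalTs ρ ts)
  Sat ρ (¬f φ)    = Sat ρ φ → ⊥
  Sat ρ (φ ∧f ψ)  = Sat ρ φ × Sat ρ ψ
  Sat ρ (φ ∨f ψ)  = Sat ρ φ ⊎ Sat ρ ψ
  Sat ρ (φ ⇒f ψ)  = Sat ρ φ → Sat ρ ψ
  Sat ρ (∀f φ)    = (x : ℤ) → Sat (x ∷ ρ) φ
  Sat ρ (∃f φ)    = Σ ℤ (λ x → Sat (x ∷ ρ) φ)

  Definable : (k : ℕ) → (Vec ℤ k → Set) → Set
  Definable k S =
    Σ ℕ λ p → Σ (Formula (k + p)) λ φ → Σ (Vec ℤ p) λ b →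
      (xs : Vec ℤ k) → S xs ⇔ Sat (xs ++ b) φ

asZ : (ℕ → Set) → Vec ℤ 1 → Set
asZ A (z ∷ []) = Σ ℕ λ n → (z ≡ + n) × A n

ℕinℤ : Vec ℤ 1 → Set
ℕinℤ = asZ (λ _ → ⊤)

LessZ : Vec ℤ 2 → Set
LessZ (x ∷ y ∷ []) = x ℤ.< y

-- A ⊆ ℕ syndetic: finite F with ℕ ⊆ ⋃_{n∈F} (A - n),
-- where k ∈ A - n iff k + n ∈ A
Syndetic : (ℕ → Set) → Set
Syndetic A = Σ (List ℕ) λ F → (k : ℕ) → Σ ℕ λ n → (n ∈ F) × A (k + n)

-- Let F witness syndeticity and M = ΣF, so that j ≤ M for every j ∈ F. Each
-- n ≥ M satisfies n − M + j ∈ A for some j ∈ F, hence ℕ is the union of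
-- {0, …, M − 1} and the finitely many translates A + (M − j), j ∈ F; conversely
-- each of these translates lies in ℕ because j ≤ M. Translates by numerals are
-- definable from +, 0, 1, so ℕ is definable, and then x < y iff y − (1 + x) ∈ ℕ.
module Submission where

open import Defs
open import Data.Product using (_×_)
open import Data.Nat using (ℕ)

open import Data.Nat as ℕ using (zero; suc; _+_; _∸_; _≤_)
import Data.Nat.Properties as ℕP
open import Data.Nat.ListAction using (sum)
open import Data.Integer as ℤ using (ℤ; +_)
import Data.Integer.Properties as ℤP
open import Algebra.Properties.AbelianGroup ℤP.+-0-abelianGroup using (∙-cancelʳ)
open import Data.Fin using (Fin; zero; suc; _↑ˡ_; _↑ʳ_; splitAt; lift)
open import Data.Fin.Properties using (splitAt⁻¹-↑ˡ; splitAt⁻¹-↑ʳ)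
open import Data.Vec using (Vec; []; _∷_; _++_; lookup; tabulate)
open import Data.Vec.Properties using (lookup-++ˡ; lookup-++ʳ; lookup∘tabulate)
open import Data.List using (List; []; _∷_; upTo)
open import Data.List.Relation.Unary.Any using (here; there)
open import Data.List.Membership.Propositional using (_∈_)
open import Data.List.Membership.Propositional.Properties using (∈-upTo⁺)
open import Data.Product using (Σ; _,_)
open import Data.Product.Function.NonDependent.Propositional using (_×-⇔_)
open import Data.Sum using (_⊎_; inj₁; inj₂; [_,_]′)
open import Data.Sum.Function.Propositional using (_⊎-⇔_)
open import Data.Unit using (tt)
open import Function using (_∘_)
open import Function.Bundles using (_⇔_; mk⇔; Equivalence)
import Function.Properties.Equivalence as ⇔
open import Function.Related.TypeIsomorphisms using (→-cong-⇔; ¬-cong-⇔)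
open import Relation.Binary.PropositionalEquality
open import Relation.Nullary using (yes; no)

open Equivalence using (to; from)

≡-resp-⇔ : ∀ {a} {A : Set a} {x x′ y y′ : A} → x ≡ x′ → y ≡ y′ → (x ≡ y) ⇔ (x′ ≡ y′)
≡-resp-⇔ refl refl = ⇔.refl

module Definability (Z : ZExpansion) where
  open ZExpansion Z

  private
    variable
      k m n p : ℕ
      b : Vec ℤ p
      S T : Vec ℤ k → Set

  mutual
    renT : (Fin n → Fin m) → Term Z n → Term Z m
    renT r (var i)    = var (r i)
    renT r (app f ts) = app f (renTs r ts)

    renTs : (Fin n → Fin m) → Vec (Term Z n) k → Vec (Term Z m) k
    renTs r []       = []
    renTs r (t ∷ ts) = renT r t ∷ renTs r ts

  renF : (Fin n → Fin m) → Formula Z n → Formula Z m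
  renF r tt         = tt
  renF r ff         = ff
  renF r (s ≐ t)    = renT r s ≐ renT r t
  renF r (rel q ts) = rel q (renTs r ts)
  renF r (¬f φ)     = ¬f renF r φ
  renF r (φ ∧f ψ)   = renF r φ ∧f renF r ψ
  renF r (φ ∨f ψ)   = renF r φ ∨f renF r ψ
  renF r (φ ⇒f ψ)   = renF r φ ⇒f renF r ψ
  renF r (∀f φ)     = ∀f (renF (lift 1 r) φ)
  renF r (∃f φ)     = ∃f (renF (lift 1 r) φ)

  module _ {r : Fin n → Fin m} {ρ : Vec ℤ n} {σ : Vec ℤ m} where

    lift-≗ : lookup σ ∘ r ≗ lookup ρ → ∀ x → lookup (x ∷ σ) ∘ lift 1 r ≗ lookup (x ∷ ρ)
    lift-≗ σr≗ρ x zero    = refl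
    lift-≗ σr≗ρ x (suc i) = σr≗ρ i

    mutual
      evalT-renT : lookup σ ∘ r ≗ lookup ρ → (t : Term Z n) → evalT Z σ (renT r t) ≡ evalT Z ρ t
      evalT-renT σr≗ρ (var i)    = σr≗ρ i
      evalT-renT σr≗ρ (app f ts) = cong (funI f) (evalTs-renTs σr≗ρ ts)

      evalTs-renTs : lookup σ ∘ r ≗ lookup ρ → (ts : Vec (Term Z n) k) →
                     evalTs Z σ (renTs r ts) ≡ evalTs Z ρ ts
      evalTs-renTs σr≗ρ []       = refl
      evalTs-renTs σr≗ρ (t ∷ ts) = cong₂ _∷_ (evalT-renT σr≗ρ t) (evalTs-renTs σr≗ρ ts)

  Sat-renF : ∀ {r : Fin n → Fin m} {ρ σ} → lookup σ ∘ r ≗ lookup ρ →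
             (φ : Formula Z n) → Sat Z σ (renF r φ) ⇔ Sat Z ρ φ
  Sat-renF σr≗ρ tt         = ⇔.refl
  Sat-renF σr≗ρ ff         = ⇔.refl
  Sat-renF σr≗ρ (s ≐ t)    = ≡-resp-⇔ (evalT-renT σr≗ρ s) (evalT-renT σr≗ρ t)
  Sat-renF σr≗ρ (rel q ts) =
    mk⇔ (subst (relI q) (evalTs-renTs σr≗ρ ts)) (subst (relI q) (sym (evalTs-renTs σr≗ρ ts)))
  Sat-renF σr≗ρ (¬f φ)     = ¬-cong-⇔ (Sat-renF σr≗ρ φ)
  Sat-renF σr≗ρ (φ ∧f ψ)   = Sat-renF σr≗ρ φ ×-⇔ Sat-renF σr≗ρ ψ
  Sat-renF σr≗ρ (φ ∨f ψ)   = Sat-renF σr≗ρ φ ⊎-⇔ Sat-renF σr≗ρ ψ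
  Sat-renF σr≗ρ (φ ⇒f ψ)   = →-cong-⇔ (Sat-renF σr≗ρ φ) (Sat-renF σr≗ρ ψ)
  Sat-renF σr≗ρ (∀f φ)     = mk⇔ (λ s x → to (Sat-renF (lift-≗ σr≗ρ x) φ) (s x))
                                 (λ s x → from (Sat-renF (lift-≗ σr≗ρ x) φ) (s x))
  Sat-renF σr≗ρ (∃f φ)     = mk⇔ (λ (x , s) → x , to (Sat-renF (lift-≗ σr≗ρ x) φ) s)
                                 (λ (x , s) → x , from (Sat-renF (lift-≗ σr≗ρ x) φ) s)

  -- Definability with a fixed tuple b of parameters, so that combining definable
  -- sets never requires merging parameter tuples.
  DefinableOver : Vec ℤ p → (Vec ℤ k → Set) → Set
  DefinableOver {p} {k} b S = Σ (Formula Z (k + p)) λ φ → ∀ xs → S xs ⇔ Sat Z (xs ++ b) φ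

  definableOver⇒definable : DefinableOver b S → Definable Z k S
  definableOver⇒definable {b = b} (φ , S⇔φ) = _ , φ , b , S⇔φ

  definable-resp : (∀ xs → S xs ⇔ T xs) → DefinableOver b S → DefinableOver b T
  definable-resp S⇔T (φ , S⇔φ) = φ , λ xs → ⇔.trans (⇔.sym (S⇔T xs)) (S⇔φ xs)

  definable-formula : (φ : Formula Z k) → DefinableOver b (λ xs → Sat Z xs φ)
  definable-formula {b = b} φ = renF (_↑ˡ _) φ , λ xs → ⇔.sym (Sat-renF (lookup-++ˡ xs b) φ)

  definable-preimage : (r : Fin k → Fin m) → DefinableOver b S →
                       DefinableOver b (λ ys → S (tabulate (lookup ys ∘ r)))
  definable-preimage {k} {m} {p} {b} r (φ , S⇔φ) =
    renF r′ φ , λ ys → ⇔.trans (S⇔φ _) (⇔.sym (Sat-renF (agree {ys} {tabulate (lookup ys ∘ r)} (sym ∘ lookup∘tabulate _)) φ))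
    where
      r′ : Fin (k + p) → Fin (m + p)
      r′ i = [ (λ j → r j ↑ˡ p) , m ↑ʳ_ ]′ (splitAt k i)

      agree : ∀ {ys xs} → lookup ys ∘ r ≗ lookup xs → lookup (ys ++ b) ∘ r′ ≗ lookup (xs ++ b)
      agree {ys} {xs} ys∘r≗xs i with splitAt k i in eq
      ... | inj₁ j = begin
        lookup (ys ++ b) (r j ↑ˡ p)  ≡⟨ lookup-++ˡ ys b (r j) ⟩
        lookup ys (r j)              ≡⟨ ys∘r≗xs j ⟩
        lookup xs j                  ≡⟨ lookup-++ˡ xs b j ⟨
        lookup (xs ++ b) (j ↑ˡ p)    ≡⟨ cong (lookup (xs ++ b)) (splitAt⁻¹-↑ˡ eq) ⟩
        lookup (xs ++ b) i           ∎
        where open ≡-Reasoning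
      ... | inj₂ j = begin
        lookup (ys ++ b) (m ↑ʳ j)    ≡⟨ lookup-++ʳ ys b j ⟩
        lookup b j                   ≡⟨ lookup-++ʳ xs b j ⟨
        lookup (xs ++ b) (k ↑ʳ j)    ≡⟨ cong (lookup (xs ++ b)) (splitAt⁻¹-↑ʳ eq) ⟩
        lookup (xs ++ b) i           ∎
        where open ≡-Reasoning

  definable-∩ : DefinableOver b S → DefinableOver b T → DefinableOver b (λ xs → S xs × T xs)
  definable-∩ (φ , S⇔φ) (ψ , T⇔ψ) = φ ∧f ψ , λ xs → S⇔φ xs ×-⇔ T⇔ψ xs

  definable-∪ : DefinableOver b S → DefinableOver b T → DefinableOver b (λ xs → S xs ⊎ T xs)
  definable-∪ (φ , S⇔φ) (ψ , T⇔ψ) = φ ∨f ψ , λ xs → S⇔φ xs ⊎-⇔ T⇔ψ xs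

  definable-⋃ : ∀ {I : Set} {S : I → Vec ℤ k → Set} (F : List I) →
                (∀ i → DefinableOver b (S i)) →
                DefinableOver b (λ xs → Σ I λ i → i ∈ F × S i xs)
  definable-⋃ []      _     = ff , λ xs → mk⇔ (λ { (_ , () , _) }) λ ()
  definable-⋃ {S = S} (i ∷ F) S-def =
    definable-resp (λ xs → ⇔.sym ∈-∷-split) (definable-∪ (S-def i) (definable-⋃ F S-def))
    where
      ∈-∷-split : ∀ {xs} → (Σ _ λ j → j ∈ i ∷ F × S j xs) ⇔ (S i xs ⊎ Σ _ λ j → j ∈ F × S j xs)
      ∈-∷-split = mk⇔
        (λ { (_ , here refl , s) → inj₁ s ; (j , there j∈F , s) → inj₂ (j , j∈F , s) })
        (λ { (inj₁ s) → i , here refl , s ; (inj₂ (j , j∈F , s)) → j , there j∈F , s })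

  definable-∃ : {S : Vec ℤ (suc k) → Set} → DefinableOver b S →
                DefinableOver b (λ xs → Σ ℤ λ y → S (y ∷ xs))
  definable-∃ (φ , S⇔φ) =
    ∃f φ , λ xs → mk⇔ (λ (y , s) → y , to (S⇔φ (y ∷ xs)) s) (λ (y , s) → y , from (S⇔φ (y ∷ xs)) s)

  definable-∃∈ : {S : Vec ℤ 1 → Set} {R : Vec ℤ (suc k) → Set} →
                 DefinableOver b S → DefinableOver b R →
                 DefinableOver b (λ xs → Σ ℤ λ y → S (y ∷ []) × R (y ∷ xs))
  definable-∃∈ S-def R-def = definable-∃ (definable-∩ (definable-preimage (λ _ → zero) S-def) R-def)

  infixl 25 _⊕_
  _⊕_ : Term Z n → Term Z n → Term Z n
  s ⊕ t = app plus (s ∷ t ∷ [])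

  numeral : ℕ → Term Z n
  numeral zero    = app zer []
  numeral (suc j) = app one [] ⊕ numeral j

  evalT-numeral : (ρ : Vec ℤ n) (j : ℕ) → evalT Z ρ (numeral j) ≡ + j
  evalT-numeral ρ zero    = zer-ok
  evalT-numeral ρ (suc j) = trans (plus-ok _ _) (cong₂ ℤ._+_ one-ok (evalT-numeral ρ j))

  evalT-⊕-numeral : (ρ : Vec ℤ n) (t : Term Z n) (j : ℕ) →
                    evalT Z ρ (t ⊕ numeral j) ≡ evalT Z ρ t ℤ.+ + j
  evalT-⊕-numeral ρ t j = trans (plus-ok _ _) (cong (λ w → evalT Z ρ t ℤ.+ w) (evalT-numeral ρ j))

  definable-singleton : (j : ℕ) → DefinableOver b (λ (xs : Vec ℤ (suc k)) → lookup xs zero ≡ + j)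
  definable-singleton j =
    definable-resp (λ xs → ≡-resp-⇔ refl (evalT-numeral xs j)) (definable-formula (var zero ≐ numeral j))

  definable-translation-graph :
    (i j : ℕ) → DefinableOver b (λ (ys : Vec ℤ 2) → lookup ys (suc zero) ℤ.+ + j ≡ lookup ys zero ℤ.+ + i)
  definable-translation-graph i j =
    definable-resp (λ ys → ≡-resp-⇔ (evalT-⊕-numeral ys (var (suc zero)) j) (evalT-⊕-numeral ys (var zero) i))
                   (definable-formula (var (suc zero) ⊕ numeral j ≐ var zero ⊕ numeral i))

  definable-gap-graph :
    DefinableOver b (λ (ys : Vec ℤ 3) →
      lookup ys zero ℤ.+ (+ 1 ℤ.+ lookup ys (suc zero)) ≡ lookup ys (suc (suc zero)))
  definable-gap-graph =
    definable-resp (λ ys → ≡-resp-⇔ (evalT-gap ys) refl)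
                   (definable-formula (var zero ⊕ (numeral 1 ⊕ var (suc zero)) ≐ var (suc (suc zero))))
    where
      evalT-gap : (ys : Vec ℤ 3) → evalT Z ys (var zero ⊕ (numeral 1 ⊕ var (suc zero))) ≡
                  lookup ys zero ℤ.+ (+ 1 ℤ.+ lookup ys (suc zero))
      evalT-gap ys = trans (plus-ok _ _)
        (cong (λ w → lookup ys zero ℤ.+ w) (trans (plus-ok _ _) (cong (ℤ._+ lookup ys (suc zero)) (evalT-numeral ys 1))))

∈⇒≤sum : ∀ {n ns} → n ∈ ns → n ≤ sum ns
∈⇒≤sum {ns = n ∷ ns} (here refl)  = ℕP.m≤m+n n (sum ns)
∈⇒≤sum {ns = m ∷ ns} (there n∈ns) = ℕP.≤-trans (∈⇒≤sum n∈ns) (ℕP.m≤n+m (sum ns) m)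

InitialSegment : ℕ → ℤ → Set
InitialSegment M x = Σ ℕ λ n → n ∈ upTo M × x ≡ + n

Translates : (ℕ → Set) → List ℕ → ℕ → ℤ → Set
Translates A F M x = Σ ℕ λ j → j ∈ F × Σ ℤ λ y → asZ A (y ∷ []) × x ℤ.+ + j ≡ y ℤ.+ + M

ℕinℤ⇔initialSegment∪translates :
  (A : ℕ → Set) (F : List ℕ) → ((k : ℕ) → Σ ℕ λ j → j ∈ F × A (k + j)) → ∀ x →
  ℕinℤ (x ∷ []) ⇔ (InitialSegment (sum F) x ⊎ Translates A F (sum F) x)
ℕinℤ⇔initialSegment∪translates A F syn x = mk⇔ cover covered
  where
    M = sum F

    cover : ℕinℤ (x ∷ []) → InitialSegment M x ⊎ Translates A F M x
    cover (n , refl , _) with n ℕ.<? M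
    ... | yes n<M = inj₁ (n , ∈-upTo⁺ n<M , refl)
    ... | no n≮M with syn (n ∸ M)
    ... | j , j∈F , a = inj₂ (j , j∈F , + (n ∸ M + j) , (_ , refl , a) , cong +_ n+j≡)
      where
        open ≡-Reasoning
        n+j≡ : n + j ≡ n ∸ M + j + M
        n+j≡ = begin
          n + j            ≡⟨ cong (_+ j) (ℕP.m∸n+n≡m (ℕP.≮⇒≥ n≮M)) ⟨
          n ∸ M + M + j    ≡⟨ ℕP.+-assoc (n ∸ M) M j ⟩
          n ∸ M + (M + j)  ≡⟨ cong (λ k → n ∸ M + k) (ℕP.+-comm M j) ⟩
          n ∸ M + (j + M)  ≡⟨ ℕP.+-assoc (n ∸ M) j M ⟨
          n ∸ M + j + M    ∎

    covered : InitialSegment M x ⊎ Translates A F M x → ℕinℤ (x ∷ [])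
    covered (inj₁ (n , _ , x≡n)) = n , x≡n , tt
    covered (inj₂ (j , j∈F , _ , (a , refl , _) , x+j≡a+M)) =
      a + M ∸ j , ∙-cancelʳ (+ j) x (+ (a + M ∸ j)) x+j≡ , tt
      where
        x+j≡ : x ℤ.+ + j ≡ + (a + M ∸ j) ℤ.+ + j
        x+j≡ = trans x+j≡a+M
                 (cong +_ (sym (ℕP.m∸n+n≡m (ℕP.≤-trans (∈⇒≤sum j∈F) (ℕP.m≤n+m M a)))))

NaturalGap : ℤ → ℤ → Set
NaturalGap x y = Σ ℤ λ z → ℕinℤ (z ∷ []) × z ℤ.+ (+ 1 ℤ.+ x) ≡ y

<⇔naturalGap : ∀ x y → x ℤ.< y ⇔ NaturalGap x y
<⇔naturalGap x y = mk⇔ gap gap⇒<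
  where
    gap : x ℤ.< y → NaturalGap x y
    gap x<y = + ℤ.∣ d ∣ , (_ , refl , tt) , d+[1+x]≡y
      where
        open ≡-Reasoning
        s = + 1 ℤ.+ x
        d = y ℤ.- s
        d+[1+x]≡y : + ℤ.∣ d ∣ ℤ.+ s ≡ y
        d+[1+x]≡y = begin
          + ℤ.∣ d ∣ ℤ.+ s       ≡⟨ cong (ℤ._+ s) (ℤP.0≤i⇒+∣i∣≡i (ℤP.i≤j⇒0≤j-i (ℤP.i<j⇒suc[i]≤j x<y))) ⟩
          y ℤ.- s ℤ.+ s         ≡⟨ ℤP.+-assoc y (ℤ.- s) s ⟩
          y ℤ.+ (ℤ.- s ℤ.+ s)   ≡⟨ cong (λ w → y ℤ.+ w) (ℤP.+-inverseˡ s) ⟩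
          y ℤ.+ + 0             ≡⟨ ℤP.+-identityʳ y ⟩
          y                     ∎

    gap⇒< : NaturalGap x y → x ℤ.< y
    gap⇒< (_ , (n , refl , _) , n+[1+x]≡y) =
      ℤP.suc[i]≤j⇒i<j (subst (+ 1 ℤ.+ x ℤ.≤_) n+[1+x]≡y (ℤP.i≤j+i (+ 1 ℤ.+ x) (+ n)))

proposition4p2 : (Z : ZExpansion) (A : ℕ → Set) →
    Definable Z 1 (asZ A) → Syndetic A →
    Definable Z 1 ℕinℤ × Definable Z 2 LessZ
proposition4p2 Z A (_ , φ , b , A⇔φ) (F , syn) =
  definableOver⇒definable ℕ-def , definableOver⇒definable <-def
  where
    open Definability Z

    ℕ-def : DefinableOver b ℕinℤ
    ℕ-def = definable-resp (λ { (x ∷ []) → ⇔.sym (ℕinℤ⇔initialSegment∪translates A F syn x) })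
      (definable-∪ (definable-⋃ (upTo (sum F)) definable-singleton)
                   (definable-⋃ F λ j → definable-∃∈ (φ , A⇔φ) (definable-translation-graph (sum F) j)))

    <-def : DefinableOver b LessZ
    <-def = definable-resp (λ { (x ∷ y ∷ []) → ⇔.sym (<⇔naturalGap x y) })
      (definable-∃∈ ℕ-def definable-gap-graph)
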